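{- Let $G$ be a circulant graph with an odd number of vertices (possibly with loops) and let $n\ge 1$. Then $K_{n,n}\otimes G$ is a circulant graph.
   Context: Graphs have no multiple edges but may have loops. $K_{n,n}$ is the complete bipartite graph with both parts of size $n$. The tensor product $G\otimes H$ has vertex set $V(G)\times V(H)$, with $(g,h)$ adjacent to $(g',h')$ iff $g$ is adjacent to $g'$ in $G$ and $h$ is adjacent to $h'$ in $H$. A graph on $N$ vertices is circulant if its vertices can be labeled by $\mathbb{Z}_N$ so that, for some set $S\subseteq\mathbb{Z}_N$ with $S=-S$, vertices $i$ and $j$ (possibly equal) are adjacent iff $j-i\in S\pmod N$. -}

module Defs where

open import Level using (Level; _⊔_; suc; Lift; lift)
open import Data.Nat as ℕ using (ℕ; _+_; _∸_; _*_)
open import Data.Nat.DivMod using (_mod_)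
open import Data.Fin using (Fin; toℕ)
open import Data.Product using (_×_; _,_; Σ; ∃; ∃-syntax)
open import Function.Bundles using (_↔_; Inverse)
open import Relation.Binary.PropositionalEquality using (_≡_) renaming (sym to ≡-sym)
open import Relation.Nullary using (¬_)

-- A graph: a vertex type with a symmetric adjacency relation
-- (loops allowed: Adj v v may hold; no multiple edges since Adj is a relation).
record Graph (ℓ : Level) : Set (Level.suc ℓ) where
  field
    V   : Set ℓ
    Adj : V → V → Set ℓ
    sym : ∀ {x y} → Adj x y → Adj y x
open Graph public

_-ₘ_ : ∀ {m} → Fin (ℕ.suc m) → Fin (ℕ.suc m) → Fin (ℕ.suc m)
_-ₘ_ {m} j i = (toℕ j + (ℕ.suc m ∸ toℕ i)) mod (ℕ.suc m)

negₘ : ∀ {m} → Fin (ℕ.suc m) → Fin (ℕ.suc m)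
negₘ {m} s = (ℕ.suc m ∸ toℕ s) mod (ℕ.suc m)

-- G is circulant on N vertices: there is a labelling of V(G) by ℤ_N
-- (a bijection Fin N ↔ V) and a set S ⊆ ℤ_N with S = -S such that
-- i ~ j iff j - i ∈ S.  Here N = suc m (N ≥ 1).
CirculantOn : ∀ {ℓ} → Graph ℓ → ℕ → Set (Level.suc ℓ)
CirculantOn {ℓ} G m =
  Σ (Fin (ℕ.suc m) ↔ V G) λ lab →
  Σ (Fin (ℕ.suc m) → Set ℓ) λ S →
    (∀ s → S s → S (negₘ s)) ×
    (∀ i j → (Adj G (Inverse.to lab i) (Inverse.to lab j) → S (j -ₘ i))
           × (S (j -ₘ i) → Adj G (Inverse.to lab i) (Inverse.to lab j)))

Circulant : ∀ {ℓ} → Graph ℓ → Set (Level.suc ℓ)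
Circulant G = ∃[ m ] CirculantOn G m

K : ∀ {ℓ} → ℕ → Graph ℓ
K {ℓ} n = record
  { V   = Lift ℓ (Fin 2 × Fin n)
  ; Adj = λ { (lift (a , _)) (lift (b , _)) → Lift ℓ (¬ (a ≡ b)) }
  ; sym = λ { {lift (a , _)} {lift (b , _)} (lift p) → lift (λ q → p (≡-sym q)) }
  }

_⊗_ : ∀ {ℓ} → Graph ℓ → Graph ℓ → Graph ℓ
G ⊗ H = record
  { V   = V G × V H
  ; Adj = λ { (g , h) (g' , h') → Adj G g g' × Adj H h h' }
  ; sym = λ { (p , q) → Graph.sym G p , Graph.sym H q }
  }

module Submission where

-- Let M = 2k + 1 be the order of G and N = 2nM.  Write x ∈ ℤ_N in mixed radix as
-- x = M(2i + s) + r and send it to the vertex with index i, side s ⊕ (r mod 2) and G-label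
-- r = x mod M; because M is odd, that side is just x mod 2.  Hence x ~ y iff y − x is odd and
-- (y − x) mod M lies in the connection set of G, so these differences form a connection set
-- for K_{n,n} ⊗ G.

open import Defs
open import Data.Nat using (ℕ; suc; _+_; _*_; _≥_)
open import Relation.Binary.PropositionalEquality using (_≡_)

open import Level using (Level; Lift; lift)
open import Data.Nat using (_∸_; _≤_; pred; NonZero)
open import Data.Nat.Properties using (+-comm; +-assoc; <⇒≤; m+[n∸m]≡n)
open import Data.Nat.DivMod
open import Data.Nat.Divisibility using (_∣_; divides; m∣m*n; n∣m*n*o)
open import Data.Nat.Solver using (module +-*-Solver)
open import Data.Fin using (Fin; toℕ; combine; remQuot)
open import Data.Fin.Patterns using (0F; 1F)
open import Data.Fin.Properties
  using (toℕ-fromℕ<; toℕ-injective; toℕ<n; toℕ-combine; remQuot-combine; combine-remQuot)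
open import Data.Product using (_×_; _,_; proj₁; proj₂; map₁)
open import Function using (_∘_)
open import Function.Bundles using (_↔_; _⇔_; mk⇔; mk↔ₛ′; Inverse; Equivalence)
open import Relation.Nullary using (¬_)
open import Data.Empty using (⊥-elim)
open import Relation.Binary.PropositionalEquality
  using (refl; trans; cong; cong₂; subst; module ≡-Reasoning) renaming (sym to ≡-sym)

toℕ-mod : ∀ a n .{{_ : NonZero n}} → toℕ (a mod n) ≡ a % n
toℕ-mod a n = toℕ-fromℕ< (m%n<n a n)

[m%n+o]%n≡[m+o]%n : ∀ m o n .{{_ : NonZero n}} → (m % n + o) % n ≡ (m + o) % n
[m%n+o]%n≡[m+o]%n m o n = begin
  (m % n + o) % n           ≡⟨ %-distribˡ-+ (m % n) o n ⟩
  (m % n % n + o % n) % n   ≡⟨ cong (λ t → (t + o % n) % n) (m%n%n≡m%n m n) ⟩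
  (m % n + o % n) % n       ≡⟨ %-distribˡ-+ m o n ⟨
  (m + o) % n               ∎
  where open ≡-Reasoning

[m+o%n]%n≡[m+o]%n : ∀ m o n .{{_ : NonZero n}} → (m + o % n) % n ≡ (m + o) % n
[m+o%n]%n≡[m+o]%n m o n = begin
  (m + o % n) % n   ≡⟨ cong (_% n) (+-comm m (o % n)) ⟩
  (o % n + m) % n   ≡⟨ [m%n+o]%n≡[m+o]%n o m n ⟩
  (o + m) % n       ≡⟨ cong (_% n) (+-comm o m) ⟩
  (m + o) % n       ∎
  where open ≡-Reasoning

[m+n+[o∸m]]%o≡n%o : ∀ {m} n {o} .{{_ : NonZero o}} → m ≤ o → (m + n + (o ∸ m)) % o ≡ n % o
[m+n+[o∸m]]%o≡n%o {m} n {o} m≤o = begin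
  (m + n + (o ∸ m)) % o     ≡⟨ cong (λ t → (t + (o ∸ m)) % o) (+-comm m n) ⟩
  (n + m + (o ∸ m)) % o     ≡⟨ cong (_% o) (+-assoc n m (o ∸ m)) ⟩
  (n + (m + (o ∸ m))) % o   ≡⟨ cong (λ t → (n + t) % o) (m+[n∸m]≡n m≤o) ⟩
  (n + o) % o               ≡⟨ [m+n]%n≡m%n n o ⟩
  n % o                     ∎
  where open ≡-Reasoning

-ₘ-correct : ∀ {m} (i j : Fin (suc m)) → (toℕ i + toℕ (j -ₘ i)) % suc m ≡ toℕ j % suc m
-ₘ-correct {m} i j = begin
  (I + toℕ (j -ₘ i)) % N          ≡⟨ cong (λ t → (I + t) % N) (toℕ-mod (J + (N ∸ I)) N) ⟩
  (I + (J + (N ∸ I)) % N) % N     ≡⟨ [m+o%n]%n≡[m+o]%n I (J + (N ∸ I)) N ⟩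
  (I + (J + (N ∸ I))) % N         ≡⟨ cong (_% N) (+-assoc I J (N ∸ I)) ⟨
  (I + J + (N ∸ I)) % N           ≡⟨ [m+n+[o∸m]]%o≡n%o J (<⇒≤ (toℕ<n i)) ⟩
  J % N                           ∎
  where
  open ≡-Reasoning
  N I J : ℕ
  N = suc m
  I = toℕ i
  J = toℕ j

-ₘ-unique : ∀ {m} (i j : Fin (suc m)) (d : ℕ) →
            (toℕ i + d) % suc m ≡ toℕ j % suc m → toℕ (j -ₘ i) ≡ d % suc m
-ₘ-unique {m} i j d i+d≡j = begin
  toℕ (j -ₘ i)                     ≡⟨ toℕ-mod (J + (N ∸ I)) N ⟩
  (J + (N ∸ I)) % N                ≡⟨ [m%n+o]%n≡[m+o]%n J (N ∸ I) N ⟨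
  (J % N + (N ∸ I)) % N            ≡⟨ cong (λ t → (t + (N ∸ I)) % N) i+d≡j ⟨
  ((I + d) % N + (N ∸ I)) % N      ≡⟨ [m%n+o]%n≡[m+o]%n (I + d) (N ∸ I) N ⟩
  (I + d + (N ∸ I)) % N            ≡⟨ [m+n+[o∸m]]%o≡n%o d (<⇒≤ (toℕ<n i)) ⟩
  d % N                            ∎
  where
  open ≡-Reasoning
  N I J : ℕ
  N = suc m
  I = toℕ i
  J = toℕ j

mod-distrib-ₘ : ∀ {m q} → suc q ∣ suc m → (i j : Fin (suc m)) →
                toℕ (j -ₘ i) mod suc q ≡ (toℕ j mod suc q) -ₘ (toℕ i mod suc q)
mod-distrib-ₘ {m} {q} Q∣N i j = toℕ-injective (begin
  toℕ (D mod Q)                    ≡⟨ toℕ-mod D Q ⟩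
  D % Q                            ≡⟨ -ₘ-unique (I mod Q) (J mod Q) D reduced ⟨
  toℕ ((J mod Q) -ₘ (I mod Q))     ∎)
  where
  open ≡-Reasoning
  N Q I J D : ℕ
  N = suc m
  Q = suc q
  I = toℕ i
  J = toℕ j
  D = toℕ (j -ₘ i)
  reduced : (toℕ (I mod Q) + D) % Q ≡ toℕ (J mod Q) % Q
  reduced = begin
    (toℕ (I mod Q) + D) % Q    ≡⟨ cong (λ t → (t + D) % Q) (toℕ-mod I Q) ⟩
    (I % Q + D) % Q            ≡⟨ [m%n+o]%n≡[m+o]%n I D Q ⟩
    (I + D) % Q                ≡⟨ m∣n⇒o%n%m≡o%m Q N (I + D) Q∣N ⟨
    (I + D) % N % Q            ≡⟨ cong (_% Q) (-ₘ-correct i j) ⟩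
    J % N % Q                  ≡⟨ m∣n⇒o%n%m≡o%m Q N J Q∣N ⟩
    J % Q                      ≡⟨ m%n%n≡m%n J Q ⟨
    J % Q % Q                  ≡⟨ cong (_% Q) (toℕ-mod J Q) ⟨
    toℕ (J mod Q) % Q          ∎

≢⇔-ₘ≡1 : (a b : Fin 2) → (¬ a ≡ b) ⇔ (b -ₘ a ≡ 1F)
≢⇔-ₘ≡1 0F 0F = mk⇔ (λ a≢a → ⊥-elim (a≢a refl)) λ ()
≢⇔-ₘ≡1 0F 1F = mk⇔ (λ _ → refl) λ _ ()
≢⇔-ₘ≡1 1F 0F = mk⇔ (λ _ → refl) λ _ ()
≢⇔-ₘ≡1 1F 1F = mk⇔ (λ a≢a → ⊥-elim (a≢a refl)) λ ()

xor : Fin 2 → Fin 2 → Fin 2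
xor 0F t  = t
xor 1F 0F = 1F
xor 1F 1F = 0F

xor-involutive : ∀ s t → xor (xor s t) t ≡ s
xor-involutive 0F 0F = refl
xor-involutive 0F 1F = refl
xor-involutive 1F 0F = refl
xor-involutive 1F 1F = refl

toℕ-xor : ∀ s t → toℕ (xor s t) ≡ (toℕ s + toℕ t) % 2
toℕ-xor 0F 0F = refl
toℕ-xor 0F 1F = refl
toℕ-xor 1F 0F = refl
toℕ-xor 1F 1F = refl

module Labelling {ℓ : Level} (G : Graph ℓ) (k n′ : ℕ) (labG : Fin (suc (2 * k)) ↔ V G) where
  M n N : ℕ
  M = suc (2 * k)
  n = suc n′
  N = n * 2 * M

  digits : Fin N → (Fin n × Fin 2) × Fin M
  digits = map₁ (remQuot {n} 2) ∘ remQuot {n * 2} M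

  undigits : (Fin n × Fin 2) × Fin M → Fin N
  undigits ((i , s) , r) = combine (combine i s) r

  digits∘undigits : ∀ d → digits (undigits d) ≡ d
  digits∘undigits ((i , s) , r) =
    trans (cong (map₁ (remQuot {n} 2)) (remQuot-combine (combine i s) r))
          (cong (_, r) (remQuot-combine i s))

  undigits∘digits : ∀ x → undigits (digits x) ≡ x
  undigits∘digits x =
    trans (cong (λ a → combine a r) (combine-remQuot {n} 2 a)) (combine-remQuot {n * 2} M x)
    where
    a = proj₁ (remQuot {n * 2} M x)
    r = proj₂ (remQuot {n * 2} M x)

  iOf : Fin N → Fin n
  iOf x = proj₁ (proj₁ (digits x))

  sOf : Fin N → Fin 2
  sOf x = proj₂ (proj₁ (digits x))

  rOf : Fin N → Fin M
  rOf x = proj₂ (digits x)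

  side : Fin N → Fin 2
  side x = xor (sOf x) (toℕ (rOf x) mod 2)

  vertex : (Fin n × Fin 2) × Fin M → V (K n ⊗ G)
  vertex ((i , s) , r) = lift (xor s (toℕ r mod 2) , i) , Inverse.to labG r

  to : Fin N → V (K n ⊗ G)
  to = vertex ∘ digits

  from : V (K n ⊗ G) → Fin N
  from (lift (t , i) , g) = undigits ((i , xor t (toℕ r mod 2)) , r)
    where r = Inverse.from labG g

  to∘from : ∀ v → to (from v) ≡ v
  to∘from (lift (t , i) , g) =
    trans (cong vertex (digits∘undigits _))
          (cong₂ (λ t g → lift (t , i) , g) (xor-involutive t _) (Inverse.strictlyInverseˡ labG g))

  from∘to : ∀ x → from (to x) ≡ x
  from∘to x
    rewrite Inverse.strictlyInverseʳ labG (rOf x)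
          | xor-involutive (sOf x) (toℕ (rOf x) mod 2) = undigits∘digits x

  lab : Fin N ↔ V (K n ⊗ G)
  lab = mk↔ₛ′ to from to∘from from∘to

  toℕ-digits : ∀ x → toℕ x ≡ M * (2 * toℕ (iOf x) + toℕ (sOf x)) + toℕ (rOf x)
  toℕ-digits x = begin
    toℕ x                           ≡⟨ cong toℕ (undigits∘digits x) ⟨
    toℕ (combine (combine i s) r)   ≡⟨ toℕ-combine (combine i s) r ⟩
    M * toℕ (combine i s) + toℕ r   ≡⟨ cong (λ t → M * t + toℕ r) (toℕ-combine i s) ⟩
    M * (2 * toℕ i + toℕ s) + toℕ r ∎
    where
    open ≡-Reasoning
    i = iOf x
    s = sOf x
    r = rOf x

  rOf≡mod : ∀ x → rOf x ≡ toℕ x mod M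
  rOf≡mod x = toℕ-injective (≡-sym (begin
    toℕ (toℕ x mod M)            ≡⟨ toℕ-mod (toℕ x) M ⟩
    toℕ x % M                    ≡⟨ cong (_% M) (toℕ-digits x) ⟩
    (M * A + toℕ (rOf x)) % M    ≡⟨ %-remove-+ˡ (toℕ (rOf x)) (m∣m*n A) ⟩
    toℕ (rOf x) % M              ≡⟨ m<n⇒m%n≡m (toℕ<n (rOf x)) ⟩
    toℕ (rOf x)                  ∎))
    where
    open ≡-Reasoning
    A = 2 * toℕ (iOf x) + toℕ (sOf x)

  side≡mod : ∀ x → side x ≡ toℕ x mod 2
  side≡mod x = toℕ-injective (begin
    toℕ (side x)                 ≡⟨ toℕ-xor s (R mod 2) ⟩
    (toℕ s + toℕ (R mod 2)) % 2  ≡⟨ cong (λ t → (toℕ s + t) % 2) (toℕ-mod R 2) ⟩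
    (toℕ s + R % 2) % 2          ≡⟨ [m+o%n]%n≡[m+o]%n (toℕ s) R 2 ⟩
    (toℕ s + R) % 2              ≡⟨ [m+kn]%n≡m%n (toℕ s + R) (I + k * (2 * I + toℕ s)) 2 ⟨
    (toℕ s + R + (I + k * (2 * I + toℕ s)) * 2) % 2 ≡⟨ cong (_% 2) (regroup I (toℕ s) R k) ⟨
    (M * (2 * I + toℕ s) + R) % 2 ≡⟨ cong (_% 2) (toℕ-digits x) ⟨
    toℕ x % 2                    ≡⟨ toℕ-mod (toℕ x) 2 ⟨
    toℕ (toℕ x mod 2)            ∎)
    where
    open ≡-Reasoning
    open +-*-Solver
    I R : ℕ
    I = toℕ (iOf x)
    s = sOf x
    R = toℕ (rOf x)
    regroup : ∀ i s r k → suc (2 * k) * (2 * i + s) + r ≡ s + r + (i + k * (2 * i + s)) * 2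
    regroup = solve 4 (λ i s r k → (con 1 :+ con 2 :* k) :* (con 2 :* i :+ s) :+ r
                                 := s :+ r :+ (i :+ k :* (con 2 :* i :+ s)) :* con 2) refl

  2∣N : 2 ∣ N
  2∣N = n∣m*n*o n M

  M∣N : M ∣ N
  M∣N = divides (n * 2) refl

  sides≢⇔odd : ∀ x y → (¬ side x ≡ side y) ⇔ (toℕ (y -ₘ x) mod 2 ≡ 1F)
  sides≢⇔odd x y rewrite side≡mod x | side≡mod y | mod-distrib-ₘ 2∣N x y =
    ≢⇔-ₘ≡1 (toℕ x mod 2) (toℕ y mod 2)

  rOf-ₘ : ∀ x y → rOf y -ₘ rOf x ≡ toℕ (y -ₘ x) mod M
  rOf-ₘ x y = trans (cong₂ _-ₘ_ (rOf≡mod y) (rOf≡mod x)) (≡-sym (mod-distrib-ₘ M∣N x y))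

K⊗-circulant : ∀ {ℓ} (G : Graph ℓ) k → CirculantOn G (2 * k) →
               ∀ n′ → CirculantOn (K (suc n′) ⊗ G) (pred (suc n′ * 2 * suc (2 * k)))
K⊗-circulant {ℓ} G k (labG , SG , SG-neg , SG-adj) n′ = lab , S , S-neg , S-adj
  where
  open Labelling G k n′ labG

  S : Fin N → Set ℓ
  S d = Lift ℓ (toℕ d mod 2 ≡ 1F) × SG (toℕ d mod M)

  -- negₘ d is 0F -ₘ d definitionally, so mod-distrib-ₘ applies with i = d, j = 0F.
  S-neg : ∀ d → S d → S (negₘ d)
  S-neg d (lift odd , d∈SG) =
    lift (trans (mod-distrib-ₘ 2∣N d 0F) (cong negₘ odd)) ,
    subst SG (≡-sym (mod-distrib-ₘ M∣N d 0F)) (SG-neg _ d∈SG)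

  S-adj : ∀ x y → (Adj (K n ⊗ G) (to x) (to y) → S (y -ₘ x))
                × (S (y -ₘ x) → Adj (K n ⊗ G) (to x) (to y))
  S-adj x y =
    (λ (lift sides≢ , gx~gy) →
       lift (Equivalence.to (sides≢⇔odd x y) sides≢) ,
       subst SG (rOf-ₘ x y) (proj₁ (SG-adj (rOf x) (rOf y)) gx~gy)) ,
    (λ (lift odd , d∈SG) →
       lift (Equivalence.from (sides≢⇔odd x y) odd) ,
       proj₂ (SG-adj (rOf x) (rOf y)) (subst SG (≡-sym (rOf-ₘ x y)) d∈SG))

theorem8 : ∀ {ℓ} (G : Graph ℓ) (k : ℕ) → CirculantOn G (2 * k)
         → (n : ℕ) → n ≥ 1 → Circulant (K n ⊗ G)
theorem8 G k circ (suc n′) _ = _ , K⊗-circulant G k circ n′
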